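{- Assume the setting described in the context. For every $v\in\{0,\dots,\tau-1\}$ and every integer $u\ge1$, $$P_{v,u}-P_{v-1,u-1}=m^{F_{v-u,u-1}}\,d_{v-u-1,u},$$ where $$d_{v-u-1,u}=\frac{m^{f_{v-1}}b_{v,u}+d_{v-u,u-1}-b_{v-1,u-1}}{l^{e_{v-u-1}}}.$$
   Context: Setting. Let $m,l\ge 2$ be coprime integers and $\tau\ge1$ an integer. Let $f_0,\dots,f_{\tau-1}$ be positive integers. Let $(a_{v,i})$, $v\in\{0,\dots,\tau-1\}$, $i\in\{0,\dots,l-1\}$, be integers with $a_{v,0}=0$ and, for $i\neq0$: $a_{v,i}\equiv -m^{f_v}i \pmod l$, $a_{v,i}\not\equiv0\pmod m$ and $a_{v,i}\not\equiv 0\pmod l$. For each $v\in\{0,\dots,\tau-1\}$ fix an admissible choice: an index $i_v\in\{1,\dots,l-1\}$, with $a_v:=a_{v,i_v}$; an integer $s_v$ with $1\le s_v\le m^{f_v}-1$ and $\gcd(s_v,m)=1$; and positive integers $e_v,r_v$ with $r_v\equiv i_v\pmod l$, $l^{e_v}s_v=m^{f_v}r_v+a_v$, and $|a_v|<\max(m^{f_v},l^{e_v})$. All indexed quantities are extended $\tau$-periodically to all integer indices. Sums. For $v\in\mathbb Z$, $u\ge0$: $F_{v,u}=\sum_{y=0}^{u-1}f_{v+y}$, $E_{v,u}=\sum_{y=0}^{u-1}e_{v+y}$, $\overline{F}_{v,u}=\sum_{y=0}^{u-1}f_{v-1-y}$, $\overline{E}_{v,u}=\sum_{y=0}^{u-1}e_{v-1-y}$.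 Iterates. Let $\mathbb Z_{\langle m,l\rangle}$ be the subring of $\mathbb Q$ of fractions whose denominators are coprime to both $m$ and $l$. Let $(n_v)_{v\in\mathbb Z}$ be a $\tau$-periodic sequence in $\mathbb Z_{\langle m,l\rangle}$ with $n_v\equiv s_v\pmod{m^{f_v}}$ and $n_{v+1}=l^{e_v}\frac{n_v-s_v}{m^{f_v}}+r_v$ for all $v$. Graded digits. $k_{v,0}=n_v$, $k_{v,u}=m^{f_{v+u}}k_{v,u+1}+d_{v,u}$ with $d_{v,u}\in\{0,\dots,m^{f_{v+u}}-1\}$, $k_{v,u+1}\in\mathbb Z_{\langle m,l\rangle}$; $j_{v,0}=n_v$, $j_{v,u}=l^{e_{v-1-u}}j_{v,u+1}+b_{v,u}$ with $b_{v,u}\in\{0,\dots,l^{e_{v-1-u}}-1\}$, $j_{v,u+1}\in\mathbb Z_{\langle m,l\rangle}$. Prefix addends. $P_{v,0}=0$ and for $u\ge1$, $P_{v,u}=\dfrac{m^{\overline{F}_{v,u}}b_{v,u}+m^{f_{v-u}}P_{v,u-1}+s_{v-u}-r_{v-u-1}}{l^{e_{v-1-u}}}$. -}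

module Defs where

open import Data.Nat as ℕ using (ℕ; zero; suc; _^_)
open import Data.Nat.Coprimality using (Coprime)
open import Data.Integer as ℤ using (ℤ; +_)
open import Data.Rational as ℚ using (ℚ; ↧ₙ_; 0ℚ)

ℕ→ℚ : ℕ → ℚ
ℕ→ℚ n = ℚ._/_ (+ n) 1

-- division of a rational by a natural number (division by 0 returns 0;
-- it is only ever used with divisors l ^ e, m ^ f which are nonzero)
_÷ℕ_ : ℚ → ℕ → ℚ
p ÷ℕ zero = 0ℚ
p ÷ℕ suc n = p ℚ.* ℚ._/_ (+ 1) (suc n)

infixl 7 _÷ℕ_

InZml : ℕ → ℕ → ℚ → Set
InZml m l q = Coprime (↧ₙ q) m Data.Product.× Coprime (↧ₙ q) l
  where import Data.Product

Fsum : (ℤ → ℕ) → ℤ → ℕ → ℕ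
Fsum f v zero = 0
Fsum f v (suc u) = Fsum f v u ℕ.+ f (v ℤ.+ + u)

Fbar : (ℤ → ℕ) → ℤ → ℕ → ℕ
Fbar f v zero = 0
Fbar f v (suc u) = Fbar f v u ℕ.+ f (v ℤ.- + 1 ℤ.- + u)

P : (m l : ℕ) (f e s r : ℤ → ℕ) (b : ℤ → ℕ → ℕ) → ℤ → ℕ → ℚ
P m l f e s r b v zero = 0ℚ
P m l f e s r b v (suc u) =
  ( ℕ→ℚ (m ^ Fbar f v (suc u)) ℚ.* ℕ→ℚ (b v (suc u))
    ℚ.+ ℕ→ℚ (m ^ f (v ℤ.- + suc u)) ℚ.* P m l f e s r b v u
    ℚ.+ ℕ→ℚ (s (v ℤ.- + suc u))
    ℚ.- ℕ→ℚ (r (v ℤ.- + suc u ℤ.- + 1)) )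
  ÷ℕ (l ^ e (v ℤ.- + 1 ℤ.- + suc u))

module Submission where

-- The data n_v are fixed points of the map n ↦ l^e (n - s)/m^f + r, and
-- the two digit expansions of the paper, (k, d) in base m^f and (j, b) in
-- base l^e, are compared through one auxiliary quantity, the "m-digit
-- candidate" δ_{w,t} = j_{w,t} - m^{f_w} j_{w+1,t+1}.  For these a
--     relation B·q = c₁ - c₂ with base-B digits c₁, c₂ forces c₁ = c₂, and a
--     relation B·q = D - b + M·b' with digits D < M, b, b' < B forces q to be
--     a digit below M.  This digit uniqueness is the only arithmetic input.
--   * For admissible data, s_v < m^{f_v} and r_v < l^{e_v} on one period,
--     hence everywhere by periodicity.
--   * For the iteration: b_{w+1,0} = r_w and j_{w+1,1} = (n_w - s_w)/m^{f_w};
--     δ_{w,t} is a digit below m^{f_w} satisfying an l-adic carry recursion;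
--     by uniqueness of m-adic digits k_{x,t} = j_{x+t,t} and d_{x,t} = δ_{x+t,t};
--     and unfolding P gives j_{v-u,1} = P_{v,u} + m^{F̄_{v,u}} j_{v,u+1}.
-- Subtracting the last identity at (v,u) and (v-1,u-1) yields the first claim,
-- and the carry recursion of δ is the second.

open import Defs
open import Data.Nat as ℕ using (ℕ; zero; suc; _^_; _⊔_; z≤n)
import Data.Nat.Properties as ℕP
import Data.Nat.Divisibility as ℕD
open import Data.Nat.Coprimality as Coprimality using (Coprime)
open import Data.Integer as ℤ using (ℤ; +_; -[1+_])
import Data.Integer.Properties as ℤP
open import Data.Integer.Divisibility as ℤd using ()
import Data.Integer.Divisibility.Signed as ℤDS
import Data.Integer.Coprimality as ℤC
open import Data.Integer.DivMod using (_%ℕ_; _/ℕ_; a≡a%ℕn+[a/ℕn]*n; n%ℕd<d)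
open import Data.Integer.Tactic.RingSolver using (solve-∀)
import Data.Nat.Tactic.RingSolver as ℕ-Solver
open import Data.Rational as ℚ using (ℚ)
import Data.Rational.Properties as ℚP
open import Data.Rational.Unnormalised as ℚᵘ using (mkℚᵘ; *≡*)
import Data.Rational.Unnormalised.Properties as ℚᵘP
open import Data.Rational.Solver using (module +-*-Solver)
open import Algebra.Properties.Group ℚP.+-0-group using () renaming (x∙y⁻¹≈ε⇒x≈y to p-q≡0⇒p≡q)
open +-*-Solver using (solve; _:=_; _:+_; _:-_; _:*_)
open import Data.Product using (Σ; _×_; _,_; proj₁; proj₂)
open import Data.Empty using (⊥-elim)
open import Relation.Nullary using (¬_)
open import Relation.Binary.Definitions using (tri<; tri≈; tri>)
open import Relation.Binary.PropositionalEquality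

ℤ→ℚ : ℤ → ℚ
ℤ→ℚ z = ℚ._/_ z 1

toℚᵘ-ℤ→ℚ : ∀ z → ℚ.toℚᵘ (ℤ→ℚ z) ℚᵘ.≃ mkℚᵘ z 0
toℚᵘ-ℤ→ℚ z = ℚP.toℚᵘ-fromℚᵘ (mkℚᵘ z 0)

ℤ→ℚ-+ : ∀ a b → ℤ→ℚ (a ℤ.+ b) ≡ ℤ→ℚ a ℚ.+ ℤ→ℚ b
ℤ→ℚ-+ a b = ℚP.toℚᵘ-injective (ℚᵘP.≃-trans (toℚᵘ-ℤ→ℚ (a ℤ.+ b)) (ℚᵘP.≃-trans
  (*≡* (over-one a b))
  (ℚᵘP.≃-sym (ℚᵘP.≃-trans (ℚP.toℚᵘ-homo-+ (ℤ→ℚ a) (ℤ→ℚ b))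
                          (ℚᵘP.+-cong (toℚᵘ-ℤ→ℚ a) (toℚᵘ-ℤ→ℚ b))))))
  where
  over-one : ∀ a b → (a ℤ.+ b) ℤ.* + 1 ≡ (a ℤ.* + 1 ℤ.+ b ℤ.* + 1) ℤ.* + 1
  over-one = solve-∀

ℤ→ℚ-* : ∀ a b → ℤ→ℚ (a ℤ.* b) ≡ ℤ→ℚ a ℚ.* ℤ→ℚ b
ℤ→ℚ-* a b = ℚP.toℚᵘ-injective (ℚᵘP.≃-trans (toℚᵘ-ℤ→ℚ (a ℤ.* b))
  (ℚᵘP.≃-sym (ℚᵘP.≃-trans (ℚP.toℚᵘ-homo-* (ℤ→ℚ a) (ℤ→ℚ b))
                          (ℚᵘP.*-cong (toℚᵘ-ℤ→ℚ a) (toℚᵘ-ℤ→ℚ b)))))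

ℤ→ℚ-neg : ∀ a → ℤ→ℚ (ℤ.- a) ≡ ℚ.- ℤ→ℚ a
ℤ→ℚ-neg a = ℚP.toℚᵘ-injective (ℚᵘP.≃-trans (toℚᵘ-ℤ→ℚ (ℤ.- a))
  (ℚᵘP.≃-sym (ℚᵘP.≃-trans (ℚP.toℚᵘ-homo‿- (ℤ→ℚ a)) (ℚᵘP.-‿cong (toℚᵘ-ℤ→ℚ a)))))

ℤ→ℚ-- : ∀ a b → ℤ→ℚ (a ℤ.- b) ≡ ℤ→ℚ a ℚ.- ℤ→ℚ b
ℤ→ℚ-- a b = trans (ℤ→ℚ-+ a (ℤ.- b)) (cong (ℤ→ℚ a ℚ.+_) (ℤ→ℚ-neg b))

ℤ→ℚ-injective : ∀ {a b} → ℤ→ℚ a ≡ ℤ→ℚ b → a ≡ b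
ℤ→ℚ-injective {a} {b} eq
  with ℚᵘP.≃-trans (ℚᵘP.≃-sym (toℚᵘ-ℤ→ℚ a)) (ℚᵘP.≃-trans (ℚP.toℚᵘ-cong eq) (toℚᵘ-ℤ→ℚ b))
... | *≡* a*1≡b*1 = trans (sym (ℤP.*-identityʳ a)) (trans a*1≡b*1 (ℤP.*-identityʳ b))

ℕ→ℚ-* : ∀ a b → ℕ→ℚ (a ℕ.* b) ≡ ℕ→ℚ a ℚ.* ℕ→ℚ b
ℕ→ℚ-* a b = trans (cong ℤ→ℚ (ℤP.pos-* a b)) (ℤ→ℚ-* (+ a) (+ b))

-- 1/(1+n) is the inverse of 1+n; the reciprocal used by ÷ℕ is (+ 1) / (1+n),
-- which is not definitionally ℚ.1/ of ℕ→ℚ (1+n), so we go through ℚᵘ.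
reciprocal-inverse : ∀ n → ℚ._/_ (+ 1) (suc n) ℚ.* ℕ→ℚ (suc n) ≡ ℚ.1ℚ
reciprocal-inverse n = ℚP.toℚᵘ-injective (ℚᵘP.≃-trans
  (ℚP.toℚᵘ-homo-* (ℚ._/_ (+ 1) (suc n)) (ℕ→ℚ (suc n)))
  (ℚᵘP.≃-trans (ℚᵘP.*-cong (ℚP.toℚᵘ-fromℚᵘ (mkℚᵘ (+ 1) n)) (toℚᵘ-ℤ→ℚ (+ suc n)))
               (*≡* (cross (+ suc n)))))
  where
  cross : ∀ x → (+ 1 ℤ.* x) ℤ.* + 1 ≡ + 1 ℤ.* (x ℤ.* + 1)
  cross = solve-∀

÷ℕ-*-inverse : ∀ N .{{_ : ℕ.NonZero N}} x → (x ÷ℕ N) ℚ.* ℕ→ℚ N ≡ x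
÷ℕ-*-inverse (suc n) x = begin
  x ℚ.* ℚ._/_ (+ 1) (suc n) ℚ.* ℕ→ℚ (suc n)   ≡⟨ ℚP.*-assoc x _ _ ⟩
  x ℚ.* (ℚ._/_ (+ 1) (suc n) ℚ.* ℕ→ℚ (suc n)) ≡⟨ cong (x ℚ.*_) (reciprocal-inverse n) ⟩
  x ℚ.* ℚ.1ℚ                                  ≡⟨ ℚP.*-identityʳ x ⟩
  x                                           ∎
  where open ≡-Reasoning

*-÷ℕ-inverse : ∀ N .{{_ : ℕ.NonZero N}} y → (ℕ→ℚ N ℚ.* y) ÷ℕ N ≡ y
*-÷ℕ-inverse (suc n) y = begin
  ℕ→ℚ (suc n) ℚ.* y ℚ.* R         ≡⟨ solve 3 (λ N y R → N :* y :* R := y :* (R :* N)) refl (ℕ→ℚ (suc n)) y R ⟩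
  y ℚ.* (R ℚ.* ℕ→ℚ (suc n))       ≡⟨ cong (y ℚ.*_) (reciprocal-inverse n) ⟩
  y ℚ.* ℚ.1ℚ                      ≡⟨ ℚP.*-identityʳ y ⟩
  y                               ∎
  where
  open ≡-Reasoning
  R = ℚ._/_ (+ 1) (suc n)

*-cancelˡ-ℕ : ∀ N .{{_ : ℕ.NonZero N}} {x y} → ℕ→ℚ N ℚ.* x ≡ ℕ→ℚ N ℚ.* y → x ≡ y
*-cancelˡ-ℕ N {x} {y} eq =
  trans (sym (*-÷ℕ-inverse N x)) (trans (cong (_÷ℕ N) eq) (*-÷ℕ-inverse N y))

coprime-* : ∀ {a b c} → Coprime a c → Coprime b c → Coprime (a ℕ.* b) c
coprime-* {a} {b} {c} a⊥c b⊥c {i} (i∣ab , i∣c) =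
  b⊥c (Coprimality.coprime-divisor i⊥a i∣ab , i∣c)
  where
  i⊥a : Coprime i a
  i⊥a (k∣i , k∣a) = a⊥c (k∣a , ℕD.∣-trans k∣i i∣c)

coprime-^ : ∀ {a c} k → Coprime a c → Coprime a (c ^ k)
coprime-^ zero    a⊥c (_ , k∣1) = ℕD.∣1⇒≡1 k∣1
coprime-^ (suc k) a⊥c =
  Coprimality.sym (coprime-* (Coprimality.sym a⊥c) (Coprimality.sym (coprime-^ k a⊥c)))

-- Membership in Z_<m,l> makes q both m^k- and
-- l^k-integral; B-integrality is what base-B digit uniqueness needs.
record B-Integral (B : ℕ) (q : ℚ) : Set where
  constructor integral
  field
    numerator   : ℤ
    denominator : ℕ
    coprime     : Coprime (suc denominator) B
    cleared     : q ℚ.* ℕ→ℚ (suc denominator) ≡ ℤ→ℚ numerator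

reduced⇒B-Integral : ∀ {X} k q → Coprime (ℚ.↧ₙ q) X → B-Integral (X ^ k) q
reduced⇒B-Integral k q@(ℚ.mkℚ z c _) q⊥X = integral z c (coprime-^ k q⊥X) clear-denominator
  where
  clear-denominator : q ℚ.* ℕ→ℚ (suc c) ≡ ℤ→ℚ z
  clear-denominator = ℚP.toℚᵘ-injective (ℚᵘP.≃-trans
    (ℚP.toℚᵘ-homo-* q (ℕ→ℚ (suc c)))
    (ℚᵘP.≃-trans (ℚᵘP.*-cong (ℚᵘP.≃-refl {ℚ.toℚᵘ q}) (toℚᵘ-ℤ→ℚ (+ suc c)))
                 (ℚᵘP.≃-sym (ℚᵘP.≃-trans (toℚᵘ-ℤ→ℚ z) (*≡* (cross z (+ suc c)))))))
    where
    cross : ∀ a x → a ℤ.* (x ℤ.* + 1) ≡ (a ℤ.* x) ℤ.* + 1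
    cross = solve-∀

B-Integral-linear : ∀ {B q₁ q₂} → B-Integral B q₁ → B-Integral B q₂ → ∀ N →
                    B-Integral B (q₁ ℚ.- ℕ→ℚ N ℚ.* q₂)
B-Integral-linear {B} {q₁} {q₂} (integral z₁ c₁ c₁⊥B eq₁) (integral z₂ c₂ c₂⊥B eq₂) N =
  integral (z₁ ℤ.* C₂ ℤ.- + N ℤ.* z₂ ℤ.* C₁) (c₂ ℕ.+ c₁ ℕ.* suc c₂) (coprime-* c₁⊥B c₂⊥B) clear
  where
  open ≡-Reasoning
  C₁ = + suc c₁
  C₂ = + suc c₂
  clear : (q₁ ℚ.- ℕ→ℚ N ℚ.* q₂) ℚ.* ℕ→ℚ (suc c₁ ℕ.* suc c₂)
          ≡ ℤ→ℚ (z₁ ℤ.* C₂ ℤ.- + N ℤ.* z₂ ℤ.* C₁)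
  clear = begin
    (q₁ ℚ.- ℕ→ℚ N ℚ.* q₂) ℚ.* ℕ→ℚ (suc c₁ ℕ.* suc c₂)
      ≡⟨ cong ((q₁ ℚ.- ℕ→ℚ N ℚ.* q₂) ℚ.*_) (ℕ→ℚ-* (suc c₁) (suc c₂)) ⟩
    (q₁ ℚ.- ℕ→ℚ N ℚ.* q₂) ℚ.* (ℤ→ℚ C₁ ℚ.* ℤ→ℚ C₂)
      ≡⟨ solve 5 (λ q₁ q₂ n x y → (q₁ :- n :* q₂) :* (x :* y) := (q₁ :* x) :* y :- n :* (q₂ :* y) :* x)
               refl q₁ q₂ (ℕ→ℚ N) (ℤ→ℚ C₁) (ℤ→ℚ C₂) ⟩
    (q₁ ℚ.* ℤ→ℚ C₁) ℚ.* ℤ→ℚ C₂ ℚ.- ℕ→ℚ N ℚ.* (q₂ ℚ.* ℤ→ℚ C₂) ℚ.* ℤ→ℚ C₁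
      ≡⟨ cong₂ (λ x y → x ℚ.* ℤ→ℚ C₂ ℚ.- ℕ→ℚ N ℚ.* y ℚ.* ℤ→ℚ C₁) eq₁ eq₂ ⟩
    ℤ→ℚ z₁ ℚ.* ℤ→ℚ C₂ ℚ.- ℕ→ℚ N ℚ.* ℤ→ℚ z₂ ℚ.* ℤ→ℚ C₁
      ≡⟨ cong₂ ℚ._-_ (sym (ℤ→ℚ-* z₁ C₂)) (sym (trans (ℤ→ℚ-* (+ N ℤ.* z₂) C₁) (cong (ℚ._* ℤ→ℚ C₁) (ℤ→ℚ-* (+ N) z₂)))) ⟩
    ℤ→ℚ (z₁ ℤ.* C₂) ℚ.- ℤ→ℚ (+ N ℤ.* z₂ ℤ.* C₁)
      ≡⟨ sym (ℤ→ℚ-- (z₁ ℤ.* C₂) (+ N ℤ.* z₂ ℤ.* C₁)) ⟩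
    ℤ→ℚ (z₁ ℤ.* C₂ ℤ.- + N ℤ.* z₂ ℤ.* C₁) ∎

B-Integral-- : ∀ {B q₁ q₂} → B-Integral B q₁ → B-Integral B q₂ → B-Integral B (q₁ ℚ.- q₂)
B-Integral-- {B} {q₁} {q₂} i₁ i₂ =
  subst (λ t → B-Integral B (q₁ ℚ.- t)) (ℚP.*-identityˡ q₂) (B-Integral-linear i₁ i₂ 1)

-- If B·q is an integer z and q is B-integral, then q is itself an integer y
-- and z = y·B: the denominator of q divides B and is coprime to it.
B-Integral-integer : ∀ B .{{_ : ℕ.NonZero B}} {q z} → B-Integral B q → ℕ→ℚ B ℚ.* q ≡ ℤ→ℚ z →
                     Σ ℤ λ y → q ≡ ℤ→ℚ y × z ≡ y ℤ.* + B
B-Integral-integer B {q} {z} (integral a c c⊥B q·C≡a) B·q≡z = y , q≡y , z≡yB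
  where
  open ≡-Reasoning
  C = + suc c
  z·C≡B·a : z ℤ.* C ≡ + B ℤ.* a
  z·C≡B·a = ℤ→ℚ-injective (begin
    ℤ→ℚ (z ℤ.* C)               ≡⟨ ℤ→ℚ-* z C ⟩
    ℤ→ℚ z ℚ.* ℤ→ℚ C             ≡⟨ cong (ℚ._* ℤ→ℚ C) (sym B·q≡z) ⟩
    ℕ→ℚ B ℚ.* q ℚ.* ℤ→ℚ C        ≡⟨ ℚP.*-assoc (ℕ→ℚ B) q (ℤ→ℚ C) ⟩
    ℕ→ℚ B ℚ.* (q ℚ.* ℤ→ℚ C)      ≡⟨ cong (ℕ→ℚ B ℚ.*_) q·C≡a ⟩
    ℕ→ℚ B ℚ.* ℤ→ℚ a              ≡⟨ sym (ℤ→ℚ-* (+ B) a) ⟩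
    ℤ→ℚ (+ B ℤ.* a)             ∎)
  B∣C·z : + B ℤd.∣ C ℤ.* z
  B∣C·z = ℕD.divides ℤ.∣ a ∣ (begin
    ℤ.∣ C ℤ.* z ∣   ≡⟨ cong ℤ.∣_∣ (trans (ℤP.*-comm C z) z·C≡B·a) ⟩
    ℤ.∣ + B ℤ.* a ∣ ≡⟨ ℤP.abs-* (+ B) a ⟩
    B ℕ.* ℤ.∣ a ∣   ≡⟨ ℕP.*-comm B ℤ.∣ a ∣ ⟩
    ℤ.∣ a ∣ ℕ.* B   ∎)
  B∣z : + B ℤDS.∣ z
  B∣z = ℤDS.∣ᵤ⇒∣ (ℤC.coprime-divisor (+ B) C z (Coprimality.sym c⊥B) B∣C·z)
  y = ℤDS._∣_.quotient B∣z
  z≡yB : z ≡ y ℤ.* + B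
  z≡yB = ℤDS._∣_.equality B∣z
  q≡y : q ≡ ℤ→ℚ y
  q≡y = *-cancelˡ-ℕ B (begin
    ℕ→ℚ B ℚ.* q           ≡⟨ B·q≡z ⟩
    ℤ→ℚ z                 ≡⟨ cong ℤ→ℚ z≡yB ⟩
    ℤ→ℚ (y ℤ.* + B)        ≡⟨ ℤ→ℚ-* y (+ B) ⟩
    ℤ→ℚ y ℚ.* ℕ→ℚ B       ≡⟨ ℚP.*-comm (ℤ→ℚ y) (ℕ→ℚ B) ⟩
    ℕ→ℚ B ℚ.* ℤ→ℚ y       ∎)

-- Base-B digit uniqueness: if B·q = c₁ - c₂ with c₁, c₂ < B and q
-- B-integral, then q is an integer y with |y|·B = |c₁ - c₂| < B, so y = 0.
digit-unique : ∀ B .{{_ : ℕ.NonZero B}} {q} c₁ c₂ → c₁ ℕ.< B → c₂ ℕ.< B → B-Integral B q →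
               ℕ→ℚ B ℚ.* q ≡ ℕ→ℚ c₁ ℚ.- ℕ→ℚ c₂ → c₁ ≡ c₂ × q ≡ ℚ.0ℚ
digit-unique B {q} c₁ c₂ c₁<B c₂<B q-int B·q≡c₁-c₂ =
  conclude (B-Integral-integer B q-int (trans B·q≡c₁-c₂ (sym (ℤ→ℚ-- (+ c₁) (+ c₂)))))
  where
  ∣c₁-c₂∣<B : ℤ.∣ + c₁ ℤ.- + c₂ ∣ ℕ.< B
  ∣c₁-c₂∣<B = subst (ℕ._< B) (cong ℤ.∣_∣ (sym (ℤP.[+m]-[+n]≡m⊖n c₁ c₂)))
                    (ℕP.≤-<-trans (ℤP.∣m⊝n∣≤m⊔n c₁ c₂) (ℕP.⊔-lub c₁<B c₂<B))
  conclude : (Σ ℤ λ y → q ≡ ℤ→ℚ y × + c₁ ℤ.- + c₂ ≡ y ℤ.* + B) → c₁ ≡ c₂ × q ≡ ℚ.0ℚ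
  conclude (y , q≡y , c₁-c₂≡yB) =
    ℤP.+-injective (ℤP.i-j≡0⇒i≡j (+ c₁) (+ c₂) c₁-c₂≡0) , trans q≡y (cong ℤ→ℚ y≡0)
    where
    ∣y∣*B<1*B : ℤ.∣ y ∣ ℕ.* B ℕ.< 1 ℕ.* B
    ∣y∣*B<1*B = subst₂ ℕ._<_ (trans (cong ℤ.∣_∣ c₁-c₂≡yB) (ℤP.abs-* y (+ B)))
                             (sym (ℕP.*-identityˡ B)) ∣c₁-c₂∣<B
    y≡0 : y ≡ + 0
    y≡0 = ℤP.∣i∣≡0⇒i≡0 (ℕP.n<1⇒n≡0 (ℕP.*-cancelʳ-< B ℤ.∣ y ∣ 1 ∣y∣*B<1*B))
    c₁-c₂≡0 : + c₁ ℤ.- + c₂ ≡ + 0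
    c₁-c₂≡0 = trans c₁-c₂≡yB (trans (cong (ℤ._* + B) y≡0) (ℤP.*-zeroˡ (+ B)))

carry-bound : ∀ {L M D b b'} y → D ℕ.< M → b ℕ.< L → b' ℕ.< L →
              + D ℤ.+ + M ℤ.* + b' ≡ + b ℤ.+ y ℤ.* + L → Σ ℕ λ N → y ≡ + N × N ℕ.< M
carry-bound {L} {M} {D} {b} {b'} (+ N) D<M b<L b'<L eq = N , refl , N<M
  where
  eqℕ : D ℕ.+ M ℕ.* b' ≡ b ℕ.+ N ℕ.* L
  eqℕ = ℤP.+-injective (let open ≡-Reasoning in begin
    + (D ℕ.+ M ℕ.* b')   ≡⟨ cong (ℤ._+_ (+ D)) (ℤP.pos-* M b') ⟩
    + D ℤ.+ + M ℤ.* + b' ≡⟨ eq ⟩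
    + b ℤ.+ + N ℤ.* + L  ≡⟨ cong (ℤ._+_ (+ b)) (sym (ℤP.pos-* N L)) ⟩
    + (b ℕ.+ N ℕ.* L)    ∎)
  N<M : N ℕ.< M
  N<M = ℕP.≰⇒> λ M≤N → ℕP.<-irrefl eqℕ (let open ℕP.≤-Reasoning in begin-strict
    D ℕ.+ M ℕ.* b'  <⟨ ℕP.+-monoˡ-< (M ℕ.* b') D<M ⟩
    M ℕ.+ M ℕ.* b'  ≡⟨ ℕP.*-suc M b' ⟨
    M ℕ.* suc b'    ≤⟨ ℕP.*-monoʳ-≤ M b'<L ⟩
    M ℕ.* L         ≤⟨ ℕP.*-monoˡ-≤ L M≤N ⟩
    N ℕ.* L         ≤⟨ ℕP.m≤n+m (N ℕ.* L) b ⟩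
    b ℕ.+ N ℕ.* L   ∎)
carry-bound {L} {M} {D} {b} {b'} -[1+ k ] D<M b<L b'<L eq =
  ⊥-elim (ℕP.<⇒≱ b<L (subst (L ℕ.≤_) sum≡b L≤sum))
  where
  move : ∀ x y z → x ≡ y ℤ.+ ℤ.- z → x ℤ.+ z ≡ y
  move x y z x≡y-z = trans (cong (ℤ._+ z) x≡y-z) (cancel y z)
    where
    cancel : ∀ y z → y ℤ.+ ℤ.- z ℤ.+ z ≡ y
    cancel = solve-∀
  sum≡b : D ℕ.+ M ℕ.* b' ℕ.+ suc k ℕ.* L ≡ b
  sum≡b = ℤP.+-injective (begin
    + (D ℕ.+ M ℕ.* b' ℕ.+ suc k ℕ.* L)       ≡⟨ cong (λ t → + D ℤ.+ t ℤ.+ + (suc k ℕ.* L)) (ℤP.pos-* M b') ⟩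
    + D ℤ.+ + M ℤ.* + b' ℤ.+ + (suc k ℕ.* L) ≡⟨ move _ (+ b) _ (trans eq (cong (ℤ._+_ (+ b)) negate)) ⟩
    + b                                       ∎)
    where
    open ≡-Reasoning
    negate : -[1+ k ] ℤ.* + L ≡ ℤ.- + (suc k ℕ.* L)
    negate = trans (sym (ℤP.neg-distribˡ-* (+ suc k) (+ L))) (cong ℤ.-_ (sym (ℤP.pos-* (suc k) L)))
  L≤sum : L ℕ.≤ D ℕ.+ M ℕ.* b' ℕ.+ suc k ℕ.* L
  L≤sum = ℕP.≤-trans (ℕP.m≤m+n L (k ℕ.* L)) (ℕP.m≤n+m (suc k ℕ.* L) (D ℕ.+ M ℕ.* b'))

carry-digit : ∀ L .{{_ : ℕ.NonZero L}} M {D b b' q} → D ℕ.< M → b ℕ.< L → b' ℕ.< L →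
              B-Integral L q → ℕ→ℚ L ℚ.* q ≡ ℕ→ℚ D ℚ.- ℕ→ℚ b ℚ.+ ℕ→ℚ M ℚ.* ℕ→ℚ b' →
              Σ ℕ λ N → q ≡ ℕ→ℚ N × N ℕ.< M
carry-digit L M {D} {b} {b'} {q} D<M b<L b'<L q-int L·q≡rhs =
  conclude (B-Integral-integer L q-int (trans L·q≡rhs (sym as-integer)))
  where
  as-integer : ℤ→ℚ (+ D ℤ.- + b ℤ.+ + M ℤ.* + b') ≡ ℕ→ℚ D ℚ.- ℕ→ℚ b ℚ.+ ℕ→ℚ M ℚ.* ℕ→ℚ b'
  as-integer = trans (ℤ→ℚ-+ (+ D ℤ.- + b) (+ M ℤ.* + b'))
                     (cong₂ ℚ._+_ (ℤ→ℚ-- (+ D) (+ b)) (ℤ→ℚ-* (+ M) (+ b')))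
  move-b : ∀ d b x z → d ℤ.- b ℤ.+ x ≡ z → d ℤ.+ x ≡ b ℤ.+ z
  move-b d b x z eq = trans (rearrange d b x) (trans (cong (ℤ._+ b) eq) (ℤP.+-comm z b))
    where
    rearrange : ∀ d b x → d ℤ.+ x ≡ d ℤ.- b ℤ.+ x ℤ.+ b
    rearrange = solve-∀
  conclude : (Σ ℤ λ y → q ≡ ℤ→ℚ y × + D ℤ.- + b ℤ.+ + M ℤ.* + b' ≡ y ℤ.* + L) →
             Σ ℕ λ N → q ≡ ℕ→ℚ N × N ℕ.< M
  conclude (y , q≡y , rhs≡yL) with carry-bound y D<M b<L b'<L (move-b (+ D) (+ b) _ _ rhs≡yL)
  ... | N , refl , N<M = N , q≡y , N<M

∣-^ : ∀ l {e} → 1 ℕ.≤ e → l ℕD.∣ l ^ e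
∣-^ l {suc e} _ = ℕD.m∣m*n (l ^ e)

-- Admissibility bounds r below L = l^e.  Write M = m^f; the admissible
-- relation is L·s = M·r + a with s < M, |a| < M ⊔ L and r ≡ i (mod l),
-- 0 < i < l.  Then r = L is impossible (l would divide i), and r > L would
-- give |a| = M·r - L·s ≥ M + L.
admissible-r<L : ∀ {l M L R S I} (A : ℤ) → .{{_ : ℕ.NonZero I}} → l ℕD.∣ L → I ℕ.< l →
                 S ℕ.< M → + l ℤd.∣ (+ R ℤ.- + I) → + (L ℕ.* S) ≡ + (M ℕ.* R) ℤ.+ A →
                 ℤ.∣ A ∣ ℕ.< M ⊔ L → R ℕ.< L
admissible-r<L {l} {M} {L} {R} {S} {I} A l∣L I<l S<M l∣R-I LS≡MR+A ∣A∣<M⊔L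
  with ℕP.<-cmp R L
... | tri< R<L _ _ = R<L
... | tri≈ _ refl _ = ⊥-elim (ℕP.<⇒≱ I<l (ℕD.∣⇒≤ l∣I))
  where
  l∣I : l ℕD.∣ I
  l∣I = ℤDS.∣⇒∣ᵤ (subst (ℤDS._∣_ (+ l)) (L-[L-I]≡I (+ L) (+ I))
          (ℤDS.∣m∣n⇒∣m-n (ℤDS.∣ᵤ⇒∣ {+ l} {+ L} l∣L) (ℤDS.∣ᵤ⇒∣ {+ l} {+ L ℤ.- + I} l∣R-I)))
    where
    L-[L-I]≡I : ∀ x y → x ℤ.- (x ℤ.- y) ≡ y
    L-[L-I]≡I = solve-∀
... | tri> _ _ L<R = ⊥-elim (ℕP.<⇒≱ ∣A∣<M⊔L (ℕP.≤-trans (ℕP.m⊔n≤m+n M L) M+L≤∣A∣))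
  where
  open ℕP.≤-Reasoning
  regroup : ∀ L S M → L ℕ.* S ℕ.+ (M ℕ.+ L) ≡ M ℕ.+ L ℕ.* suc S
  regroup = ℕ-Solver.solve-∀
  collect : ∀ L M → M ℕ.+ L ℕ.* M ≡ M ℕ.* suc L
  collect = ℕ-Solver.solve-∀
  LS+[M+L]≤MR : L ℕ.* S ℕ.+ (M ℕ.+ L) ℕ.≤ M ℕ.* R
  LS+[M+L]≤MR = begin
    L ℕ.* S ℕ.+ (M ℕ.+ L)  ≡⟨ regroup L S M ⟩
    M ℕ.+ L ℕ.* suc S      ≤⟨ ℕP.+-monoʳ-≤ M (ℕP.*-monoʳ-≤ L S<M) ⟩
    M ℕ.+ L ℕ.* M          ≡⟨ collect L M ⟩
    M ℕ.* suc L            ≤⟨ ℕP.*-monoʳ-≤ M L<R ⟩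
    M ℕ.* R                ∎
  M+L≤∣A∣ : M ℕ.+ L ℕ.≤ ℤ.∣ A ∣
  M+L≤∣A∣ = subst (M ℕ.+ L ℕ.≤_) (sym ∣A∣≡MR∸LS)
    (ℕP.m+n≤o⇒m≤o∸n (M ℕ.+ L) (subst (ℕ._≤ M ℕ.* R) (ℕP.+-comm (L ℕ.* S) (M ℕ.+ L)) LS+[M+L]≤MR))
    where
    isolate : ∀ x a → a ≡ x ℤ.+ a ℤ.- x
    isolate = solve-∀
    A≡LS-MR : A ≡ + (L ℕ.* S) ℤ.- + (M ℕ.* R)
    A≡LS-MR = trans (isolate (+ (M ℕ.* R)) A) (cong (ℤ._- + (M ℕ.* R)) (sym LS≡MR+A))
    ∣A∣≡MR∸LS : ℤ.∣ A ∣ ≡ M ℕ.* R ℕ.∸ L ℕ.* S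
    ∣A∣≡MR∸LS = trans (cong ℤ.∣_∣ (trans A≡LS-MR (ℤP.[+m]-[+n]≡m⊖n (L ℕ.* S) (M ℕ.* R))))
                      (ℤP.∣⊖∣-≤ (ℕP.m+n≤o⇒m≤o (L ℕ.* S) LS+[M+L]≤MR))

Periodic : ℕ → {A : Set} → (ℤ → A) → Set
Periodic τ g = ∀ v → g (v ℤ.+ + τ) ≡ g v

periodic-shift : ∀ τ {A : Set} (g : ℤ → A) → Periodic τ g → ∀ x t → g (x ℤ.+ t ℤ.* + τ) ≡ g x
periodic-shift τ g g-per x (+ n) = shift-ℕ x n
  where
  shift-ℕ : ∀ x n → g (x ℤ.+ + n ℤ.* + τ) ≡ g x
  shift-ℕ x zero    = cong g (no-shift x (+ τ))
    where
    no-shift : ∀ x t → x ℤ.+ + 0 ℤ.* t ≡ x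
    no-shift = solve-∀
  shift-ℕ x (suc n) = trans (cong g (one-more x (+ n) (+ τ))) (trans (g-per _) (shift-ℕ x n))
    where
    one-more : ∀ x n t → x ℤ.+ (+ 1 ℤ.+ n) ℤ.* t ≡ (x ℤ.+ n ℤ.* t) ℤ.+ t
    one-more = solve-∀
periodic-shift τ g g-per x -[1+ n ] =
  sym (trans (cong g (undo x (+ suc n) (+ τ))) (periodic-shift τ g g-per (x ℤ.+ -[1+ n ] ℤ.* + τ) (+ suc n)))
  where
  undo : ∀ x k t → x ≡ (x ℤ.+ ℤ.- k ℤ.* t) ℤ.+ k ℤ.* t
  undo = solve-∀

periodic-everywhere : ∀ τ .{{_ : ℕ.NonZero τ}} (g h : ℤ → ℕ) → Periodic τ g → Periodic τ h →
                      (R : ℕ → ℕ → Set) → (∀ v → + 0 ℤ.≤ v → v ℤ.< + τ → R (g v) (h v)) →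
                      ∀ w → R (g w) (h w)
periodic-everywhere τ g h g-per h-per R on-period w =
  subst₂ R (reduce g g-per) (reduce h h-per) (on-period w₀ (ℤ.+≤+ z≤n) w₀<τ)
  where
  w₀ = + (w %ℕ τ)
  w₀<τ : w₀ ℤ.< + τ
  w₀<τ = ℤ.+<+ (n%ℕd<d w τ)
  reduce : (k : ℤ → ℕ) → Periodic τ k → k w₀ ≡ k w
  reduce k k-per = sym (trans (cong k (a≡a%ℕn+[a/ℕn]*n w τ)) (periodic-shift τ k k-per w₀ (w /ℕ τ)))

Fbar-unfold : ∀ f v u → Fbar f v (suc u) ≡ f (v ℤ.- + 1) ℕ.+ Fbar f (v ℤ.- + 1) u
Fbar-unfold f v zero =
  trans (cong f (ℤP.+-identityʳ (v ℤ.- + 1))) (sym (ℕP.+-identityʳ (f (v ℤ.- + 1))))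
Fbar-unfold f v (suc u) = begin
  Fbar f v (suc u) ℕ.+ f (v ℤ.- + 1 ℤ.- + suc u)
    ≡⟨ cong (ℕ._+ f (v ℤ.- + 1 ℤ.- + suc u)) (Fbar-unfold f v u) ⟩
  f (v ℤ.- + 1) ℕ.+ Fbar f (v ℤ.- + 1) u ℕ.+ f (v ℤ.- + 1 ℤ.- + suc u)
    ≡⟨ ℕP.+-assoc (f (v ℤ.- + 1)) (Fbar f (v ℤ.- + 1) u) _ ⟩
  f (v ℤ.- + 1) ℕ.+ (Fbar f (v ℤ.- + 1) u ℕ.+ f (v ℤ.- + 1 ℤ.- + suc u))
    ≡⟨ cong (λ i → f (v ℤ.- + 1) ℕ.+ (Fbar f (v ℤ.- + 1) u ℕ.+ f i)) (regroup v (+ u)) ⟩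
  f (v ℤ.- + 1) ℕ.+ (Fbar f (v ℤ.- + 1) u ℕ.+ f (v ℤ.- + 1 ℤ.- + 1 ℤ.- + u)) ∎
  where
  open ≡-Reasoning
  regroup : ∀ v u → v ℤ.- + 1 ℤ.- (+ 1 ℤ.+ u) ≡ v ℤ.- + 1 ℤ.- + 1 ℤ.- u
  regroup = solve-∀

Fbar≡Fsum : ∀ f v u → Fbar f v u ≡ Fsum f (v ℤ.- + u) u
Fbar≡Fsum f v zero = refl
Fbar≡Fsum f v (suc u) = begin
  Fbar f v (suc u)                                        ≡⟨ Fbar-unfold f v u ⟩
  f (v ℤ.- + 1) ℕ.+ Fbar f (v ℤ.- + 1) u                 ≡⟨ cong (f (v ℤ.- + 1) ℕ.+_) (Fbar≡Fsum f (v ℤ.- + 1) u) ⟩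
  f (v ℤ.- + 1) ℕ.+ Fsum f (v ℤ.- + 1 ℤ.- + u) u         ≡⟨ cong (λ i → f (v ℤ.- + 1) ℕ.+ Fsum f i u) (start v (+ u)) ⟩
  f (v ℤ.- + 1) ℕ.+ Fsum f (v ℤ.- + suc u) u             ≡⟨ ℕP.+-comm (f (v ℤ.- + 1)) _ ⟩
  Fsum f (v ℤ.- + suc u) u ℕ.+ f (v ℤ.- + 1)             ≡⟨ cong (λ i → Fsum f (v ℤ.- + suc u) u ℕ.+ f i) (last v (+ u)) ⟩
  Fsum f (v ℤ.- + suc u) u ℕ.+ f (v ℤ.- + suc u ℤ.+ + u) ∎
  where
  open ≡-Reasoning
  start : ∀ v u → v ℤ.- + 1 ℤ.- u ≡ v ℤ.- (+ 1 ℤ.+ u)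
  start = solve-∀
  last : ∀ v u → v ℤ.- + 1 ≡ v ℤ.- (+ 1 ℤ.+ u) ℤ.+ u
  last = solve-∀

-- The bounds s_w < m^{f_w}
-- and r_w < l^{e_w} are taken at every index; the theorem derives them from
-- admissibility and periodicity.
module Iteration
  (m l : ℕ) .{{_ : ℕ.NonZero m}} .{{_ : ℕ.NonZero l}}
  (f e s r : ℤ → ℕ)
  (s<m^f : ∀ w → s w ℕ.< m ^ f w)
  (r<l^e : ∀ w → r w ℕ.< l ^ e w)
  (n : ℤ → ℚ)
  (X-int : ∀ v → InZml m l ((n v ℚ.- ℕ→ℚ (s v)) ÷ℕ (m ^ f v)))
  (n-step : ∀ v → n (v ℤ.+ + 1)
              ≡ ℕ→ℚ (l ^ e v) ℚ.* ((n v ℚ.- ℕ→ℚ (s v)) ÷ℕ (m ^ f v)) ℚ.+ ℕ→ℚ (r v))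
  (k : ℤ → ℕ → ℚ) (d : ℤ → ℕ → ℕ)
  (k-0 : ∀ v → k v 0 ≡ n v)
  (k-step : ∀ v u → k v u ≡ ℕ→ℚ (m ^ f (v ℤ.+ + u)) ℚ.* k v (suc u) ℚ.+ ℕ→ℚ (d v u))
  (d< : ∀ v u → d v u ℕ.< m ^ f (v ℤ.+ + u))
  (k-int : ∀ v u → InZml m l (k v (suc u)))
  (j : ℤ → ℕ → ℚ) (b : ℤ → ℕ → ℕ)
  (j-0 : ∀ v → j v 0 ≡ n v)
  (j-step : ∀ v u → j v u ≡ ℕ→ℚ (l ^ e (v ℤ.- + 1 ℤ.- + u)) ℚ.* j v (suc u) ℚ.+ ℕ→ℚ (b v u))
  (b< : ∀ v u → b v u ℕ.< l ^ e (v ℤ.- + 1 ℤ.- + u))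
  (j-int : ∀ v u → InZml m l (j v (suc u)))
  where

  -- Powers of the bases are nonzero (instance search cannot find the
  -- exponent on its own, so these are passed explicitly).
  m^≢0 : ∀ i → ℕ.NonZero (m ^ i)
  m^≢0 i = ℕP.m^n≢0 m i
  l^≢0 : ∀ i → ℕ.NonZero (l ^ i)
  l^≢0 i = ℕP.m^n≢0 l i

  M : ℤ → ℚ
  M w = ℕ→ℚ (m ^ f w)

  X : ℤ → ℚ
  X w = (n w ℚ.- ℕ→ℚ (s w)) ÷ℕ (m ^ f w)

  n≡M·X+s : ∀ w → n w ≡ M w ℚ.* X w ℚ.+ ℕ→ℚ (s w)
  n≡M·X+s w = begin
    n w                                ≡⟨ solve 2 (λ x y → x := (x :- y) :+ y) refl (n w) (ℕ→ℚ (s w)) ⟩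
    (n w ℚ.- ℕ→ℚ (s w)) ℚ.+ ℕ→ℚ (s w)  ≡⟨ cong (ℚ._+ ℕ→ℚ (s w)) (sym (÷ℕ-*-inverse (m ^ f w) {{m^≢0 (f w)}} _)) ⟩
    X w ℚ.* M w ℚ.+ ℕ→ℚ (s w)          ≡⟨ cong (ℚ._+ ℕ→ℚ (s w)) (ℚP.*-comm (X w) (M w)) ⟩
    M w ℚ.* X w ℚ.+ ℕ→ℚ (s w)          ∎
    where open ≡-Reasoning

  -- The l-adic expansion of n_{w+1} starts with digit r_w and quotient X_w:
  -- n_{w+1} = l^{e_w} j_{w+1,1} + b_{w+1,0} = l^{e_w} X_w + r_w are two
  -- base-l^{e_w} splittings, so digit uniqueness identifies them.
  first-l-digit : ∀ w → b (w ℤ.+ + 1) 0 ≡ r w × j (w ℤ.+ + 1) 1 ≡ X w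
  first-l-digit w = conclude (digit-unique (l ^ e w) {{l^≢0 (e w)}} (r w) (b v 0) (r<l^e w) b<Λ q-int Λ·q≡r-b)
    where
    open ≡-Reasoning
    v = w ℤ.+ + 1
    Λ = ℕ→ℚ (l ^ e w)
    unshift : ∀ w → w ℤ.+ + 1 ℤ.- + 1 ℤ.- + 0 ≡ w
    unshift = solve-∀
    n-v : n v ≡ Λ ℚ.* j v 1 ℚ.+ ℕ→ℚ (b v 0)
    n-v = trans (sym (j-0 v))
      (subst (λ i → j v 0 ≡ ℕ→ℚ (l ^ e i) ℚ.* j v 1 ℚ.+ ℕ→ℚ (b v 0)) (unshift w) (j-step v 0))
    b<Λ : b v 0 ℕ.< l ^ e w
    b<Λ = subst (λ i → b v 0 ℕ.< l ^ e i) (unshift w) (b< v 0)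
    q-int : B-Integral (l ^ e w) (j v 1 ℚ.- X w)
    q-int = B-Integral-- (reduced⇒B-Integral (e w) (j v 1) (proj₂ (j-int v 0)))
                         (reduced⇒B-Integral (e w) (X w) (proj₂ (X-int w)))
    Λ·q≡r-b : Λ ℚ.* (j v 1 ℚ.- X w) ≡ ℕ→ℚ (r w) ℚ.- ℕ→ℚ (b v 0)
    Λ·q≡r-b = begin
      Λ ℚ.* (j v 1 ℚ.- X w)
        ≡⟨ solve 5 (λ L J X B R → L :* (J :- X) := (L :* J :+ B) :- (L :* X :+ R) :+ R :- B)
                 refl Λ (j v 1) (X w) (ℕ→ℚ (b v 0)) (ℕ→ℚ (r w)) ⟩
      (Λ ℚ.* j v 1 ℚ.+ ℕ→ℚ (b v 0)) ℚ.- (Λ ℚ.* X w ℚ.+ ℕ→ℚ (r w)) ℚ.+ ℕ→ℚ (r w) ℚ.- ℕ→ℚ (b v 0)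
        ≡⟨ cong₂ (λ x y → x ℚ.- y ℚ.+ ℕ→ℚ (r w) ℚ.- ℕ→ℚ (b v 0)) (sym n-v) (sym (n-step w)) ⟩
      n v ℚ.- n v ℚ.+ ℕ→ℚ (r w) ℚ.- ℕ→ℚ (b v 0)
        ≡⟨ solve 3 (λ N R B → N :- N :+ R :- B := R :- B) refl (n v) (ℕ→ℚ (r w)) (ℕ→ℚ (b v 0)) ⟩
      ℕ→ℚ (r w) ℚ.- ℕ→ℚ (b v 0) ∎
    conclude : r w ≡ b v 0 × j v 1 ℚ.- X w ≡ ℚ.0ℚ → b v 0 ≡ r w × j v 1 ≡ X w
    conclude (r≡b , q≡0) = sym r≡b , p-q≡0⇒p≡q (j v 1) (X w) q≡0

  -- The m-adic split n_w = m^{f_w} X_w + s_w and the l-adic split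
  -- n_w = l^{e_{w-1}} j_{w,1} + r_{w-1} together relate consecutive first
  -- l-adic quotients.
  l-prefix-step : ∀ w → M w ℚ.* j (w ℤ.+ + 1) 1 ℚ.+ ℕ→ℚ (s w) ℚ.- ℕ→ℚ (r (w ℤ.- + 1))
                        ≡ ℕ→ℚ (l ^ e (w ℤ.- + 1)) ℚ.* j w 1
  l-prefix-step w = begin
    M w ℚ.* j (w ℤ.+ + 1) 1 ℚ.+ ℕ→ℚ (s w) ℚ.- R
      ≡⟨ cong (λ t → M w ℚ.* t ℚ.+ ℕ→ℚ (s w) ℚ.- R) (proj₂ (first-l-digit w)) ⟩
    M w ℚ.* X w ℚ.+ ℕ→ℚ (s w) ℚ.- R     ≡⟨ cong (ℚ._- R) (sym (n≡M·X+s w)) ⟩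
    n w ℚ.- R                            ≡⟨ cong (ℚ._- R) n≡Λ·j+r ⟩
    Λ ℚ.* j w 1 ℚ.+ R ℚ.- R              ≡⟨ solve 3 (λ L J R → L :* J :+ R :- R := L :* J) refl Λ (j w 1) R ⟩
    Λ ℚ.* j w 1                          ∎
    where
    open ≡-Reasoning
    Λ = ℕ→ℚ (l ^ e (w ℤ.- + 1))
    R = ℕ→ℚ (r (w ℤ.- + 1))
    up-down : ∀ w → w ℤ.- + 1 ℤ.+ + 1 ≡ w
    up-down = solve-∀
    b≡r : b w 0 ≡ r (w ℤ.- + 1)
    b≡r = trans (cong (λ i → b i 0) (sym (up-down w))) (proj₁ (first-l-digit (w ℤ.- + 1)))
    n≡Λ·j+r : n w ≡ Λ ℚ.* j w 1 ℚ.+ R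
    n≡Λ·j+r = trans (sym (j-0 w)) (trans (j-step w 0)
      (cong₂ (λ i t → ℕ→ℚ (l ^ e i) ℚ.* j w 1 ℚ.+ ℕ→ℚ t) (ℤP.+-identityʳ (w ℤ.- + 1)) b≡r))

  -- Candidate m-adic digit: δ_{w,t} = j_{w,t} - m^{f_w} j_{w+1,t+1}.
  δ : ℤ → ℕ → ℚ
  δ w t = j w t ℚ.- M w ℚ.* j (w ℤ.+ + 1) (suc t)

  δ-0 : ∀ w → δ w 0 ≡ ℕ→ℚ (s w)
  δ-0 w = begin
    j w 0 ℚ.- M w ℚ.* j (w ℤ.+ + 1) 1
      ≡⟨ cong₂ (λ x y → x ℚ.- M w ℚ.* y) (trans (j-0 w) (n≡M·X+s w)) (proj₂ (first-l-digit w)) ⟩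
    M w ℚ.* X w ℚ.+ ℕ→ℚ (s w) ℚ.- M w ℚ.* X w
      ≡⟨ solve 3 (λ M X S → M :* X :+ S :- M :* X := S) refl (M w) (X w) (ℕ→ℚ (s w)) ⟩
    ℕ→ℚ (s w) ∎
    where open ≡-Reasoning

  carry-index : ∀ w t → w ℤ.+ + 1 ℤ.- + 1 ℤ.- + suc t ≡ w ℤ.- + 1 ℤ.- + t
  carry-index w t = index w (+ t)
    where
    index : ∀ w t → w ℤ.+ + 1 ℤ.- + 1 ℤ.- (+ 1 ℤ.+ t) ≡ w ℤ.- + 1 ℤ.- t
    index = solve-∀

  δ-carry : ∀ w t → ℕ→ℚ (l ^ e (w ℤ.- + 1 ℤ.- + t)) ℚ.* δ w (suc t)
                    ≡ δ w t ℚ.- ℕ→ℚ (b w t) ℚ.+ M w ℚ.* ℕ→ℚ (b (w ℤ.+ + 1) (suc t))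
  δ-carry w t = begin
    Λ ℚ.* (J₁ ℚ.- M w ℚ.* J₂)
      ≡⟨ solve 6 (λ L M J₁ J₂ B B' → L :* (J₁ :- M :* J₂) := ((L :* J₁ :+ B) :- M :* (L :* J₂ :+ B')) :- B :+ M :* B')
               refl Λ (M w) J₁ J₂ B B' ⟩
    ((Λ ℚ.* J₁ ℚ.+ B) ℚ.- M w ℚ.* (Λ ℚ.* J₂ ℚ.+ B')) ℚ.- B ℚ.+ M w ℚ.* B'
      ≡⟨ cong₂ (λ x y → (x ℚ.- M w ℚ.* y) ℚ.- B ℚ.+ M w ℚ.* B') (sym (j-step w t)) (sym step₁) ⟩
    (j w t ℚ.- M w ℚ.* j (w ℤ.+ + 1) (suc t)) ℚ.- B ℚ.+ M w ℚ.* B' ∎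
    where
    open ≡-Reasoning
    Λ = ℕ→ℚ (l ^ e (w ℤ.- + 1 ℤ.- + t))
    J₁ = j w (suc t)
    J₂ = j (w ℤ.+ + 1) (suc (suc t))
    B = ℕ→ℚ (b w t)
    B' = ℕ→ℚ (b (w ℤ.+ + 1) (suc t))
    step₁ : j (w ℤ.+ + 1) (suc t) ≡ Λ ℚ.* J₂ ℚ.+ B'
    step₁ = subst (λ i → j (w ℤ.+ + 1) (suc t) ≡ ℕ→ℚ (l ^ e i) ℚ.* J₂ ℚ.+ B')
                  (carry-index w t) (j-step (w ℤ.+ + 1) (suc t))

  -- Each δ_{w,t} is a natural number below m^{f_w}: it starts at s_w and the
  -- carry recursion preserves this (carry-digit with L = l^{e_{w-1-t}}).
  δ-digit : ∀ t w → Σ ℕ λ D → δ w t ≡ ℕ→ℚ D × D ℕ.< m ^ f w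
  δ-digit zero    w = s w , δ-0 w , s<m^f w
  δ-digit (suc t) w = next (δ-digit t w)
    where
    E = e (w ℤ.- + 1 ℤ.- + t)
    next : (Σ ℕ λ D → δ w t ≡ ℕ→ℚ D × D ℕ.< m ^ f w) →
           Σ ℕ λ D → δ w (suc t) ≡ ℕ→ℚ D × D ℕ.< m ^ f w
    next (D , δ≡D , D<m^f) =
      carry-digit (l ^ E) {{l^≢0 E}} (m ^ f w) D<m^f (b< w t) b'<l^E q-int
        (trans (δ-carry w t) (cong (λ x → x ℚ.- ℕ→ℚ (b w t) ℚ.+ M w ℚ.* ℕ→ℚ (b (w ℤ.+ + 1) (suc t))) δ≡D))
      where
      b'<l^E : b (w ℤ.+ + 1) (suc t) ℕ.< l ^ E
      b'<l^E = subst (λ i → b (w ℤ.+ + 1) (suc t) ℕ.< l ^ e i) (carry-index w t) (b< (w ℤ.+ + 1) (suc t))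
      q-int : B-Integral (l ^ E) (δ w (suc t))
      q-int = B-Integral-linear (reduced⇒B-Integral E (j w (suc t)) (proj₂ (j-int w t)))
                (reduced⇒B-Integral E (j (w ℤ.+ + 1) (suc (suc t))) (proj₂ (j-int (w ℤ.+ + 1) (suc t))))
                (m ^ f w)

  shift-index : ∀ x t → x ℤ.+ + t ℤ.+ + 1 ≡ x ℤ.+ + suc t
  shift-index x t = index x (+ t)
    where
    index : ∀ x t → x ℤ.+ t ℤ.+ + 1 ≡ x ℤ.+ (+ 1 ℤ.+ t)
    index = solve-∀

  -- The m-adic expansion of n_x is read off from the l-adic data,
  -- k_{x,t} = j_{x+t,t}: with w = x+t, k_{x,t} = m^{f_w} k_{x,t+1} + d_{x,t}
  -- and j_{w,t} = m^{f_w} j_{w+1,t+1} + δ_{w,t} are base-m^{f_w} splittings.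
  k≡j : ∀ t x → k x t ≡ j (x ℤ.+ + t) t
  k≡j zero    x = trans (k-0 x) (trans (sym (j-0 x)) (cong (λ i → j i 0) (sym (ℤP.+-identityʳ x))))
  k≡j (suc t) x = next (δ-digit t w)
    where
    w = x ℤ.+ + t
    K′ = k x (suc t)
    J′ = j (w ℤ.+ + 1) (suc t)
    next : (Σ ℕ λ D → δ w t ≡ ℕ→ℚ D × D ℕ.< m ^ f w) → K′ ≡ j (x ℤ.+ + suc t) (suc t)
    next (D , δ≡D , D<m^f) = trans (p-q≡0⇒p≡q K′ J′ (proj₂ D≡d×K′-J′≡0)) (cong (λ i → j i (suc t)) (shift-index x t))
      where
      open ≡-Reasoning
      q-int : B-Integral (m ^ f w) (K′ ℚ.- J′)
      q-int = B-Integral-- (reduced⇒B-Integral (f w) K′ (proj₁ (k-int x t)))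
                           (reduced⇒B-Integral (f w) J′ (proj₁ (j-int (w ℤ.+ + 1) t)))
      M·q≡D-d : M w ℚ.* (K′ ℚ.- J′) ≡ ℕ→ℚ D ℚ.- ℕ→ℚ (d x t)
      M·q≡D-d = begin
        M w ℚ.* (K′ ℚ.- J′)
          ≡⟨ solve 4 (λ M K′ J′ d → M :* (K′ :- J′) := (M :* K′ :+ d) :- M :* J′ :- d) refl (M w) K′ J′ (ℕ→ℚ (d x t)) ⟩
        (M w ℚ.* K′ ℚ.+ ℕ→ℚ (d x t)) ℚ.- M w ℚ.* J′ ℚ.- ℕ→ℚ (d x t)
          ≡⟨ cong (λ y → y ℚ.- M w ℚ.* J′ ℚ.- ℕ→ℚ (d x t)) (trans (sym (k-step x t)) (k≡j t x)) ⟩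
        δ w t ℚ.- ℕ→ℚ (d x t)
          ≡⟨ cong (ℚ._- ℕ→ℚ (d x t)) δ≡D ⟩
        ℕ→ℚ D ℚ.- ℕ→ℚ (d x t) ∎
      D≡d×K′-J′≡0 : D ≡ d x t × K′ ℚ.- J′ ≡ ℚ.0ℚ
      D≡d×K′-J′≡0 = digit-unique (m ^ f w) {{m^≢0 (f w)}} D (d x t) D<m^f (d< x t) q-int M·q≡D-d

  δ≡d : ∀ x t w → x ℤ.+ + t ≡ w → δ w t ≡ ℕ→ℚ (d x t)
  δ≡d x t w refl = begin
    j w t ℚ.- M w ℚ.* j (w ℤ.+ + 1) (suc t)
      ≡⟨ cong₂ (λ y z → y ℚ.- M w ℚ.* z) (sym (k≡j t x))
               (trans (cong (λ i → j i (suc t)) (shift-index x t)) (sym (k≡j (suc t) x))) ⟩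
    k x t ℚ.- M w ℚ.* k x (suc t)
      ≡⟨ cong (ℚ._- M w ℚ.* k x (suc t)) (k-step x t) ⟩
    M w ℚ.* k x (suc t) ℚ.+ ℕ→ℚ (d x t) ℚ.- M w ℚ.* k x (suc t)
      ≡⟨ solve 3 (λ M K d → M :* K :+ d :- M :* K := d) refl (M w) (k x (suc t)) (ℕ→ℚ (d x t)) ⟩
    ℕ→ℚ (d x t) ∎
    where open ≡-Reasoning

  Pre : ℤ → ℕ → ℚ
  Pre = P m l f e s r b

  -- One unfolding of P.  Assuming j_{v-u,1} = P_{v,u} + m^{F̄_{v,u}} j_{v,u+1},
  -- the numerator of P_{v,u+1} is l^{e_{w-1}} (j_{w,1} - m^{F̄_{v,u+1}} j_{v,u+2})
  -- for w = v-u-1, by the l-adic step of j_{v,u+1} and l-prefix-step at w.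
  prefix-step : ∀ v u → j (v ℤ.- + u) 1 ≡ Pre v u ℚ.+ ℕ→ℚ (m ^ Fbar f v u) ℚ.* j v (suc u) →
                Pre v (suc u) ≡ j (v ℤ.- + suc u) 1 ℚ.- ℕ→ℚ (m ^ Fbar f v (suc u)) ℚ.* j v (suc (suc u))
  prefix-step v u decomposition =
    trans (cong (_÷ℕ (l ^ E)) numerator) (*-÷ℕ-inverse (l ^ E) {{l^≢0 E}} _)
    where
    open ≡-Reasoning
    w = v ℤ.- + suc u
    E = e (v ℤ.- + 1 ℤ.- + suc u)
    Λ = ℕ→ℚ (l ^ E)
    A = ℕ→ℚ (m ^ Fbar f v u)
    G = ℕ→ℚ (m ^ Fbar f v (suc u))
    J₁ = j v (suc u)
    J₂ = j v (suc (suc u))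
    B = ℕ→ℚ (b v (suc u))
    S = ℕ→ℚ (s w)
    R = ℕ→ℚ (r (w ℤ.- + 1))
    last : ∀ v u → v ℤ.- + 1 ℤ.- u ≡ v ℤ.- (+ 1 ℤ.+ u)
    last = solve-∀
    next : ∀ v u → v ℤ.- (+ 1 ℤ.+ u) ℤ.+ + 1 ≡ v ℤ.- u
    next = solve-∀
    below : ∀ v u → v ℤ.- (+ 1 ℤ.+ u) ℤ.- + 1 ≡ v ℤ.- + 1 ℤ.- (+ 1 ℤ.+ u)
    below = solve-∀
    G≡A·M : G ≡ A ℚ.* M w
    G≡A·M = trans (cong ℕ→ℚ (trans (ℕP.^-distribˡ-+-* m (Fbar f v u) (f (v ℤ.- + 1 ℤ.- + u)))
                                   (cong (λ i → m ^ Fbar f v u ℕ.* m ^ f i) (last v (+ u)))))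
                  (ℕ→ℚ-* (m ^ Fbar f v u) (m ^ f w))
    J₁-B≡Λ·J₂ : J₁ ℚ.- B ≡ Λ ℚ.* J₂
    J₁-B≡Λ·J₂ = trans (cong (ℚ._- B) (j-step v (suc u)))
                      (solve 3 (λ L J B → L :* J :+ B :- B := L :* J) refl Λ J₂ B)
    prefix-w : M w ℚ.* j (v ℤ.- + u) 1 ℚ.+ S ℚ.- R ≡ Λ ℚ.* j w 1
    prefix-w = subst₂ (λ i i′ → M w ℚ.* j i 1 ℚ.+ S ℚ.- R ≡ ℕ→ℚ (l ^ e i′) ℚ.* j w 1)
                      (next v (+ u)) (below v (+ u)) (l-prefix-step w)
    numerator : G ℚ.* B ℚ.+ M w ℚ.* Pre v u ℚ.+ S ℚ.- R ≡ Λ ℚ.* (j w 1 ℚ.- G ℚ.* J₂)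
    numerator = begin
      G ℚ.* B ℚ.+ M w ℚ.* Pre v u ℚ.+ S ℚ.- R
        ≡⟨ cong (λ g → g ℚ.* B ℚ.+ M w ℚ.* Pre v u ℚ.+ S ℚ.- R) G≡A·M ⟩
      A ℚ.* M w ℚ.* B ℚ.+ M w ℚ.* Pre v u ℚ.+ S ℚ.- R
        ≡⟨ solve 7 (λ A M B P S R J → A :* M :* B :+ M :* P :+ S :- R := (M :* (P :+ A :* J) :+ S :- R) :- A :* M :* (J :- B))
                 refl A (M w) B (Pre v u) S R J₁ ⟩
      (M w ℚ.* (Pre v u ℚ.+ A ℚ.* J₁) ℚ.+ S ℚ.- R) ℚ.- A ℚ.* M w ℚ.* (J₁ ℚ.- B)
        ≡⟨ cong₂ (λ p q → (M w ℚ.* p ℚ.+ S ℚ.- R) ℚ.- A ℚ.* M w ℚ.* q) (sym decomposition) J₁-B≡Λ·J₂ ⟩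
      (M w ℚ.* j (v ℤ.- + u) 1 ℚ.+ S ℚ.- R) ℚ.- A ℚ.* M w ℚ.* (Λ ℚ.* J₂)
        ≡⟨ cong (ℚ._- A ℚ.* M w ℚ.* (Λ ℚ.* J₂)) prefix-w ⟩
      Λ ℚ.* j w 1 ℚ.- A ℚ.* M w ℚ.* (Λ ℚ.* J₂)
        ≡⟨ solve 4 (λ L J G J₂ → L :* J :- G :* (L :* J₂) := L :* (J :- G :* J₂)) refl Λ (j w 1) (A ℚ.* M w) J₂ ⟩
      Λ ℚ.* (j w 1 ℚ.- A ℚ.* M w ℚ.* J₂)
        ≡⟨ cong (λ g → Λ ℚ.* (j w 1 ℚ.- g ℚ.* J₂)) (sym G≡A·M) ⟩
      Λ ℚ.* (j w 1 ℚ.- G ℚ.* J₂) ∎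

  prefix-decomposition : ∀ u v → j (v ℤ.- + u) 1 ≡ Pre v u ℚ.+ ℕ→ℚ (m ^ Fbar f v u) ℚ.* j v (suc u)
  prefix-decomposition zero v =
    trans (cong (λ i → j i 1) (ℤP.+-identityʳ v))
          (sym (trans (ℚP.+-identityˡ _) (ℚP.*-identityˡ (j v 1))))
  prefix-decomposition (suc u) v = begin
    j (v ℤ.- + suc u) 1
      ≡⟨ solve 3 (λ x g y → x := x :- g :* y :+ g :* y) refl (j (v ℤ.- + suc u) 1) G J₂ ⟩
    j (v ℤ.- + suc u) 1 ℚ.- G ℚ.* J₂ ℚ.+ G ℚ.* J₂
      ≡⟨ cong (ℚ._+ G ℚ.* J₂) (sym (prefix-step v u (prefix-decomposition u v))) ⟩
    Pre v (suc u) ℚ.+ G ℚ.* J₂ ∎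
    where
    open ≡-Reasoning
    G = ℕ→ℚ (m ^ Fbar f v (suc u))
    J₂ = j v (suc (suc u))

  δ-below : ∀ v u → δ (v ℤ.- + 1) (suc u) ≡ ℕ→ℚ (d (v ℤ.- + suc u ℤ.- + 1) (suc u))
  δ-below v u = δ≡d (v ℤ.- + suc u ℤ.- + 1) (suc u) (v ℤ.- + 1) (index v (+ u))
    where
    index : ∀ v u → v ℤ.- (+ 1 ℤ.+ u) ℤ.- + 1 ℤ.+ (+ 1 ℤ.+ u) ≡ v ℤ.- + 1
    index = solve-∀

  -- First claim: the decompositions at (v,u+1) and (v-1,u) share the
  -- left-hand side j_{v-u-1,1}; their difference is m^{F̄_{v-1,u}} δ_{v-1,u+1}.
  prefix-difference : ∀ v u →
    Pre v (suc u) ℚ.- Pre (v ℤ.- + 1) u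
      ≡ ℕ→ℚ (m ^ Fsum f (v ℤ.- + suc u) u) ℚ.* ℕ→ℚ (d (v ℤ.- + suc u ℤ.- + 1) (suc u))
  prefix-difference v u = begin
    P₁ ℚ.- P₀
      ≡⟨ solve 6 (λ P₁ P₀ G′ G J₂ J₁ → P₁ :- P₀ := (P₁ :+ G′ :* J₂) :- (P₀ :+ G :* J₁) :+ G :* J₁ :- G′ :* J₂)
               refl P₁ P₀ G′ G J₂ J₁ ⟩
    (P₁ ℚ.+ G′ ℚ.* J₂) ℚ.- (P₀ ℚ.+ G ℚ.* J₁) ℚ.+ G ℚ.* J₁ ℚ.- G′ ℚ.* J₂
      ≡⟨ cong₂ (λ p q → p ℚ.- q ℚ.+ G ℚ.* J₁ ℚ.- G′ ℚ.* J₂)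
               (sym (prefix-decomposition (suc u) v)) (sym decomposition-below) ⟩
    Jw ℚ.- Jw ℚ.+ G ℚ.* J₁ ℚ.- G′ ℚ.* J₂
      ≡⟨ cong (λ g → Jw ℚ.- Jw ℚ.+ G ℚ.* J₁ ℚ.- g ℚ.* J₂) G′≡M·G ⟩
    Jw ℚ.- Jw ℚ.+ G ℚ.* J₁ ℚ.- M v₁ ℚ.* G ℚ.* J₂
      ≡⟨ solve 5 (λ Jw G J₁ M J₂ → Jw :- Jw :+ G :* J₁ :- M :* G :* J₂ := G :* (J₁ :- M :* J₂))
               refl Jw G J₁ (M v₁) J₂ ⟩
    G ℚ.* (J₁ ℚ.- M v₁ ℚ.* J₂)
      ≡⟨ cong₂ ℚ._*_ G≡m^Fsum (trans (cong (λ i → J₁ ℚ.- M v₁ ℚ.* j i (suc (suc u))) (sym (up-down v)))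
                                        (δ-below v u)) ⟩
    ℕ→ℚ (m ^ Fsum f (v ℤ.- + suc u) u) ℚ.* ℕ→ℚ (d (v ℤ.- + suc u ℤ.- + 1) (suc u)) ∎
    where
    open ≡-Reasoning
    v₁ = v ℤ.- + 1
    P₁ = Pre v (suc u)
    P₀ = Pre v₁ u
    G′ = ℕ→ℚ (m ^ Fbar f v (suc u))
    G = ℕ→ℚ (m ^ Fbar f v₁ u)
    J₂ = j v (suc (suc u))
    J₁ = j v₁ (suc u)
    Jw = j (v ℤ.- + suc u) 1
    up-down : ∀ v → v ℤ.- + 1 ℤ.+ + 1 ≡ v
    up-down = solve-∀
    start : ∀ v u → v ℤ.- + 1 ℤ.- u ≡ v ℤ.- (+ 1 ℤ.+ u)
    start = solve-∀
    decomposition-below : Jw ≡ P₀ ℚ.+ G ℚ.* J₁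
    decomposition-below = subst (λ i → j i 1 ≡ P₀ ℚ.+ G ℚ.* J₁) (start v (+ u)) (prefix-decomposition u v₁)
    G′≡M·G : G′ ≡ M v₁ ℚ.* G
    G′≡M·G = trans (cong ℕ→ℚ (trans (cong (m ^_) (Fbar-unfold f v u)) (ℕP.^-distribˡ-+-* m (f v₁) (Fbar f v₁ u))))
                   (ℕ→ℚ-* (m ^ f v₁) (m ^ Fbar f v₁ u))
    G≡m^Fsum : G ≡ ℕ→ℚ (m ^ Fsum f (v ℤ.- + suc u) u)
    G≡m^Fsum = cong (λ F → ℕ→ℚ (m ^ F)) (trans (Fbar≡Fsum f v₁ u) (cong (λ i → Fsum f i u) (start v (+ u))))

  -- Second claim: the carry recursion of δ at (v-1,u), read through δ = d.
  digit-recursion : ∀ v u →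
    ℕ→ℚ (d (v ℤ.- + suc u ℤ.- + 1) (suc u))
      ≡ (ℕ→ℚ (m ^ f (v ℤ.- + 1)) ℚ.* ℕ→ℚ (b v (suc u))
          ℚ.+ ℕ→ℚ (d (v ℤ.- + suc u) u) ℚ.- ℕ→ℚ (b (v ℤ.- + 1) u))
        ÷ℕ (l ^ e (v ℤ.- + suc u ℤ.- + 1))
  digit-recursion v u =
    trans (sym (*-÷ℕ-inverse (l ^ E) {{l^≢0 E}} D)) (cong (_÷ℕ (l ^ E)) carry)
    where
    open ≡-Reasoning
    v₁ = v ℤ.- + 1
    E = e (v ℤ.- + suc u ℤ.- + 1)
    D = ℕ→ℚ (d (v ℤ.- + suc u ℤ.- + 1) (suc u))
    B = ℕ→ℚ (b v₁ u)
    exponent : ∀ v u → v ℤ.- + 1 ℤ.- + 1 ℤ.- u ≡ v ℤ.- (+ 1 ℤ.+ u) ℤ.- + 1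
    exponent = solve-∀
    up-down : ∀ v → v ℤ.- + 1 ℤ.+ + 1 ≡ v
    up-down = solve-∀
    stay : ∀ v u → v ℤ.- (+ 1 ℤ.+ u) ℤ.+ u ≡ v ℤ.- + 1
    stay = solve-∀
    carry : ℕ→ℚ (l ^ E) ℚ.* D ≡ M v₁ ℚ.* ℕ→ℚ (b v (suc u)) ℚ.+ ℕ→ℚ (d (v ℤ.- + suc u) u) ℚ.- B
    carry = begin
      ℕ→ℚ (l ^ E) ℚ.* D
        ≡⟨ cong₂ (λ i y → ℕ→ℚ (l ^ e i) ℚ.* y) (sym (exponent v (+ u))) (sym (δ-below v u)) ⟩
      ℕ→ℚ (l ^ e (v₁ ℤ.- + 1 ℤ.- + u)) ℚ.* δ v₁ (suc u)
        ≡⟨ δ-carry v₁ u ⟩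
      δ v₁ u ℚ.- B ℚ.+ M v₁ ℚ.* ℕ→ℚ (b (v₁ ℤ.+ + 1) (suc u))
        ≡⟨ cong₂ (λ y i → y ℚ.- B ℚ.+ M v₁ ℚ.* ℕ→ℚ (b i (suc u)))
                 (δ≡d (v ℤ.- + suc u) u v₁ (stay v (+ u))) (up-down v) ⟩
      ℕ→ℚ (d (v ℤ.- + suc u) u) ℚ.- B ℚ.+ M v₁ ℚ.* ℕ→ℚ (b v (suc u))
        ≡⟨ solve 4 (λ d B M b → d :- B :+ M :* b := M :* b :+ d :- B)
                 refl (ℕ→ℚ (d (v ℤ.- + suc u) u)) B (M v₁) (ℕ→ℚ (b v (suc u))) ⟩
      M v₁ ℚ.* ℕ→ℚ (b v (suc u)) ℚ.+ ℕ→ℚ (d (v ℤ.- + suc u) u) ℚ.- B ∎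

-- Corollary 4.2.  Admissibility bounds s_v and r_v on one period, periodicity
-- extends the bounds to all indices, and the two claims are prefix-difference
-- and digit-recursion.
corollary4p2 :
  (m l τ : ℕ) → 2 ℕ.≤ m → 2 ℕ.≤ l → Coprime m l → 1 ℕ.≤ τ →
  (f e s r i : ℤ → ℕ) (a : ℤ → ℕ → ℤ) →
  -- τ-periodicity of all indexed data
  (∀ v → f (v ℤ.+ + τ) ≡ f v) → (∀ v → e (v ℤ.+ + τ) ≡ e v) →
  (∀ v → s (v ℤ.+ + τ) ≡ s v) → (∀ v → r (v ℤ.+ + τ) ≡ r v) →
  (∀ v → i (v ℤ.+ + τ) ≡ i v) → (∀ v k → a (v ℤ.+ + τ) k ≡ a v k) →
  -- f_v positive; conditions on a_{v,i}
  (∀ v → + 0 ℤ.≤ v → v ℤ.< + τ → 1 ℕ.≤ f v) →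
  (∀ v → + 0 ℤ.≤ v → v ℤ.< + τ → a v 0 ≡ + 0) →
  (∀ v k → + 0 ℤ.≤ v → v ℤ.< + τ → 1 ℕ.≤ k → k ℕ.< l →
     (+ l ℤd.∣ (a v k ℤ.+ + (m ^ f v ℕ.* k)))
     × ¬ (+ m ℤd.∣ a v k) × ¬ (+ l ℤd.∣ a v k)) →
  -- admissible choice (i_v, s_v, e_v, r_v), with a_v = a_{v,i_v}
  (∀ v → + 0 ℤ.≤ v → v ℤ.< + τ →
     (1 ℕ.≤ i v × i v ℕ.< l)
     × (1 ℕ.≤ s v × s v ℕ.≤ m ^ f v ℕ.∸ 1 × Coprime (s v) m)
     × (1 ℕ.≤ e v × 1 ℕ.≤ r v)
     × (+ l ℤd.∣ (+ r v ℤ.- + i v))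
     × (+ (l ^ e v ℕ.* s v) ≡ + (m ^ f v ℕ.* r v) ℤ.+ a v (i v))
     × (ℤ.∣ a v (i v) ∣ ℕ.< (m ^ f v) ⊔ (l ^ e v))) →
  -- iterates n_v ∈ Z_<m,l>
  (n : ℤ → ℚ) →
  (∀ v → n (v ℤ.+ + τ) ≡ n v) →
  (∀ v → InZml m l (n v)) →
  (∀ v → InZml m l ((n v ℚ.- ℕ→ℚ (s v)) ÷ℕ (m ^ f v))) →
  (∀ v → n (v ℤ.+ + 1)
           ≡ ℕ→ℚ (l ^ e v) ℚ.* ((n v ℚ.- ℕ→ℚ (s v)) ÷ℕ (m ^ f v)) ℚ.+ ℕ→ℚ (r v)) →
  -- graded digits k, d
  (k : ℤ → ℕ → ℚ) (d : ℤ → ℕ → ℕ) →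
  (∀ v → k v 0 ≡ n v) →
  (∀ v u → k v u ≡ ℕ→ℚ (m ^ f (v ℤ.+ + u)) ℚ.* k v (suc u) ℚ.+ ℕ→ℚ (d v u)) →
  (∀ v u → d v u ℕ.< m ^ f (v ℤ.+ + u)) →
  (∀ v u → InZml m l (k v (suc u))) →
  -- graded digits j, b
  (j : ℤ → ℕ → ℚ) (b : ℤ → ℕ → ℕ) →
  (∀ v → j v 0 ≡ n v) →
  (∀ v u → j v u ≡ ℕ→ℚ (l ^ e (v ℤ.- + 1 ℤ.- + u)) ℚ.* j v (suc u) ℚ.+ ℕ→ℚ (b v u)) →
  (∀ v u → b v u ℕ.< l ^ e (v ℤ.- + 1 ℤ.- + u)) →
  (∀ v u → InZml m l (j v (suc u))) →
  -- conclusion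
  ∀ v → + 0 ℤ.≤ v → v ℤ.< + τ → ∀ u → 1 ℕ.≤ u →
    (P m l f e s r b v u ℚ.- P m l f e s r b (v ℤ.- + 1) (u ℕ.∸ 1)
       ≡ ℕ→ℚ (m ^ Fsum f (v ℤ.- + u) (u ℕ.∸ 1)) ℚ.* ℕ→ℚ (d (v ℤ.- + u ℤ.- + 1) u))
    × (ℕ→ℚ (d (v ℤ.- + u ℤ.- + 1) u)
       ≡ (ℕ→ℚ (m ^ f (v ℤ.- + 1)) ℚ.* ℕ→ℚ (b v u)
           ℚ.+ ℕ→ℚ (d (v ℤ.- + u) (u ℕ.∸ 1))
           ℚ.- ℕ→ℚ (b (v ℤ.- + 1) (u ℕ.∸ 1)))
         ÷ℕ (l ^ e (v ℤ.- + u ℤ.- + 1)))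
corollary4p2 m l τ m≥2 l≥2 _ τ≥1 f e s r i a f-per e-per s-per r-per _ _ _ _ _ admissible
             n _ _ X-int n-step k d k-0 k-step d< k-int j b j-0 j-step b< j-int v _ _ (suc u) _ =
  prefix-difference v u , digit-recursion v u
  where
  instance
    m≢0 : ℕ.NonZero m
    m≢0 = ℕ.>-nonZero (ℕP.<-trans ℕP.0<1+n m≥2)
    l≢0 : ℕ.NonZero l
    l≢0 = ℕ.>-nonZero (ℕP.<-trans ℕP.0<1+n l≥2)
    τ≢0 : ℕ.NonZero τ
    τ≢0 = ℕ.>-nonZero τ≥1
  s<m^f : ∀ w → s w ℕ.< m ^ f w
  s<m^f = periodic-everywhere τ s f s-per f-per (λ x y → x ℕ.< m ^ y) λ v 0≤v v<τ →
    let (_ , (_ , s≤m^f-1 , _) , _) = admissible v 0≤v v<τ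
    in ℕP.m≤pred[n]⇒suc[m]≤n {{ℕP.m^n≢0 m (f v)}} s≤m^f-1
  r<l^e : ∀ w → r w ℕ.< l ^ e w
  r<l^e = periodic-everywhere τ r e r-per e-per (λ x y → x ℕ.< l ^ y) λ v 0≤v v<τ →
    let ((1≤i , i<l) , (_ , s≤m^f-1 , _) , (1≤e , _) , l∣r-i , ls≡mr+a , ∣a∣<) = admissible v 0≤v v<τ
    in admissible-r<L (a v (i v)) {{ℕ.>-nonZero 1≤i}} (∣-^ l 1≤e) i<l
         (ℕP.m≤pred[n]⇒suc[m]≤n {{ℕP.m^n≢0 m (f v)}} s≤m^f-1) l∣r-i ls≡mr+a ∣a∣<
  open Iteration m l f e s r s<m^f r<l^e n X-int n-step k d k-0 k-step d< k-int j b j-0 j-step b< j-int
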